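{- Let $\Gamma$ be a finite $(G,2)$-geodesic-transitive digraph of valency $3$, where $G\leq\mathrm{Aut}(\Gamma)$. Then $\Gamma$ is $(G,2)$-arc-transitive.
   Context: A digraph $\Gamma$ consists of a finite vertex set $V(\Gamma)$ with an antisymmetric irreflexive relation $\rightarrow$; an arc is an ordered pair $(u,v)$ with $u\rightarrow v$; $\Gamma^+(v)=\{w: v\rightarrow w\}$ and the valency is $|\Gamma^+(v)|$. The distance $d_\Gamma(u,v)$ is the length of a shortest directed path from $u$ to $v$. An $s$-arc is a sequence $(v_0,\dots,v_s)$ with $v_i\rightarrow v_{i+1}$ for all $i$; it is an $s$-geodesic if $d_\Gamma(v_0,v_s)=s$. $\Gamma$ is $(G,s)$-geodesic-transitive if $G$ is transitive on the set of $i$-geodesics for each $i\leq s$, and $(G,2)$-arc-transitive if $G$ is transitive on the set of $2$-arcs. -}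

module Defs where

open import Data.Nat using (ℕ; zero; suc; _<_; _≤_)
open import Data.Fin using (Fin)
open import Data.Bool using (Bool; true; false)
open import Data.List using (length; filter; allFin)
open import Data.Vec using (Vec; []; _∷_; map; head; last)
open import Data.Product using (Σ; _×_; ∃; _,_)
open import Data.Empty using (⊥)
open import Data.Unit using (⊤)
open import Relation.Nullary using (¬_)
open import Relation.Binary.PropositionalEquality using (_≡_; _≢_)
open import Data.Fin.Permutation using (Permutation′; _⟨$⟩ʳ_; id; flip; _∘ₚ_)
open import Data.Bool using (T)
open import Relation.Nullary.Decidable using (T?)

record Digraph : Set where
  field
    n      : ℕ
    adj    : Fin n → Fin n → Bool
    irrefl : ∀ v → adj v v ≡ false
    antisym : ∀ u v → adj u v ≡ true → adj v u ≡ false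

module _ (Γ : Digraph) where
  open Digraph Γ

  Arc : Fin n → Fin n → Set
  Arc u v = T (adj u v)

  outValency : Fin n → ℕ
  outValency v = length (filter (λ w → T? (adj v w)) (allFin n))

  HasValency : ℕ → Set
  HasValency k = ∀ v → outValency v ≡ k

  data Walk : Fin n → Fin n → ℕ → Set where
    stop : ∀ {u} → Walk u u zero
    step : ∀ {u w v k} → Arc u w → Walk w v k → Walk u v (suc k)

  Dist : Fin n → Fin n → ℕ → Set
  Dist u v k = Walk u v k × (∀ j → j < k → ¬ Walk u v j)

  IsSArc : ∀ {s} → Vec (Fin n) (suc s) → Set
  IsSArc (v ∷ []) = ⊤
  IsSArc (u ∷ v ∷ vs) = Arc u v × IsSArc (v ∷ vs)

  IsGeodesic : ∀ s → Vec (Fin n) (suc s) → Set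
  IsGeodesic s vs = IsSArc vs × Dist (head vs) (last vs) s

  IsAut : Permutation′ n → Set
  IsAut g = ∀ u v → adj (g ⟨$⟩ʳ u) (g ⟨$⟩ʳ v) ≡ adj u v

  record IsAutSubgroup (G : Permutation′ n → Set) : Set where
    field
      aut   : ∀ g → G g → IsAut g
      hasId : G id
      comp  : ∀ g h → G g → G h → G (g ∘ₚ h)
      inv   : ∀ g → G g → G (flip g)

  TransitiveOn : (G : Permutation′ n → Set) → ∀ {m} → (Vec (Fin n) m → Set) → Set
  TransitiveOn G P = ∀ x y → P x → P y → Σ _ λ g → G g × map (g ⟨$⟩ʳ_) x ≡ y

  GeodesicTransitive : (G : Permutation′ n → Set) → ℕ → Set
  GeodesicTransitive G s = ∀ i → i ≤ s → TransitiveOn G (IsGeodesic i)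

  ArcTransitive : (G : Permutation′ n → Set) → ℕ → Set
  ArcTransitive G s = TransitiveOn G (IsSArc {s})

-- A transitive triangle u → v → w, u → w cannot exist.  By arc-transitivity
-- every arc lies on such a triangle in every position, so u also has an
-- out-neighbour x → v; a second common out-neighbour of u and v besides w
-- would give u four out-neighbours, hence w is the only one.  Take p with
-- v → p, w → p and q with v → q, q → w; both (u,v,p) and (u,v,q) are
-- 2-geodesics, so some k ∈ G maps the first to the second.  As k fixes u
-- and v it fixes w, and carries w → p to w → q, contradicting q → w.  With
-- no transitive triangles every 2-arc is a 2-geodesic, so transitivity on
-- 2-geodesics is transitivity on 2-arcs.
module Submission where

open import Defs
open import Data.Bool using (T)
open import Data.Bool.Properties using (T-≡)
open import Data.Fin using (Fin; _≟_)
open import Data.Fin.Permutation using (Permutation′; _⟨$⟩ʳ_)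
open import Data.List using (List; []; _∷_; length)
open import Data.List.Properties using (length-removeAt′)
open import Data.List.Membership.Propositional using (_∈_)
open import Data.List.Membership.Propositional.Properties using (∈-filter⁺; ∈-allFin)
open import Data.List.Relation.Unary.All as All using (All; []; _∷_)
open import Data.List.Relation.Unary.AllPairs using ([]; _∷_)
open import Data.List.Relation.Unary.Any using (here; there; index; _─_)
open import Data.List.Relation.Unary.Unique.Propositional using (Unique)
open import Data.Nat using (suc; _≤_; _<_; z≤n; s≤s)
open import Data.Nat.Properties using (≤-refl; module ≤-Reasoning)
open import Data.Product using (Σ; ∃; _×_; _,_)
open import Data.Unit using (tt)
open import Data.Vec using (Vec; []; _∷_)
open import Data.Vec.Properties using (∷-injectiveˡ; ∷-injectiveʳ)
open import Function using (Equivalence)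
open import Relation.Nullary using (¬_; yes; no; contradiction)
open import Relation.Nullary.Decidable using (T?)
open import Relation.Binary.PropositionalEquality
  using (_≡_; _≢_; refl; sym; subst)

∈-─ : ∀ {a} {A : Set a} {x y : A} {ys : List A} (x∈ys : x ∈ ys) →
      y ∈ ys → x ≢ y → y ∈ (ys ─ x∈ys)
∈-─ (here refl) (here refl) x≢y = contradiction refl x≢y
∈-─ (here _)    (there y∈ys) _  = y∈ys
∈-─ (there _)   (here y≡z)   _  = here y≡z
∈-─ (there x∈ys) (there y∈ys) x≢y = there (∈-─ x∈ys y∈ys x≢y)

Unique⇒length≤ : ∀ {a} {A : Set a} {xs ys : List A} →
                 Unique xs → All (_∈ ys) xs → length xs ≤ length ys
Unique⇒length≤ [] [] = z≤n
Unique⇒length≤ {xs = x ∷ xs} {ys} (x∉xs ∷ xs-unique) (x∈ys ∷ xs⊆ys) = begin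
  suc (length xs)          ≤⟨ s≤s (Unique⇒length≤ xs-unique xs⊆ys─x) ⟩
  suc (length (ys ─ x∈ys)) ≡⟨ sym (length-removeAt′ ys (index x∈ys)) ⟩
  length ys                ∎
  where
  open ≤-Reasoning
  xs⊆ys─x : All (_∈ (ys ─ x∈ys)) xs
  xs⊆ys─x = All.zipWith (λ (x≢y , y∈ys) → ∈-─ x∈ys y∈ys x≢y) (x∉xs , xs⊆ys)

module _ (Γ : Digraph) where
  open Digraph Γ

  infix 4 _⟶_
  _⟶_ : Fin n → Fin n → Set
  _⟶_ = Arc Γ

  ⟶-irrefl : ∀ {u} → ¬ u ⟶ u
  ⟶-irrefl {u} = subst T (irrefl u)

  ⟶-asym : ∀ {u v} → u ⟶ v → ¬ v ⟶ u
  ⟶-asym {u} {v} u⟶v = subst T (antisym u v (Equivalence.to T-≡ u⟶v))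

  Unique⇒length≤valency : ∀ {k u} {xs : List (Fin n)} → HasValency Γ k →
                          Unique xs → All (u ⟶_) xs → length xs ≤ k
  Unique⇒length≤valency {u = u} valency xs-unique u⟶xs =
    subst (_ ≤_) (valency u)
      (Unique⇒length≤ xs-unique (All.map (∈-filter⁺ (λ w → T? (adj u w)) (∈-allFin _)) u⟶xs))

  ⟶⇒1-geodesic : ∀ {u v} → u ⟶ v → IsGeodesic Γ 1 (u ∷ v ∷ [])
  ⟶⇒1-geodesic u⟶v = (u⟶v , tt) , step u⟶v stop , shorter
    where
    shorter : ∀ j → j < 1 → ¬ Walk Γ _ _ j
    shorter 0 _ stop = ⟶-irrefl u⟶v
    shorter (suc _) (s≤s ())

  chordless-2-arc⇒2-geodesic : ∀ {u v w} → u ⟶ v → v ⟶ w → ¬ u ⟶ w →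
                     IsGeodesic Γ 2 (u ∷ v ∷ w ∷ [])
  chordless-2-arc⇒2-geodesic {u} {v} {w} u⟶v v⟶w u↛w =
    (u⟶v , v⟶w , tt) , step u⟶v (step v⟶w stop) , shorter
    where
    shorter : ∀ j → j < 2 → ¬ Walk Γ u w j
    shorter 0 _ stop            = ⟶-asym u⟶v v⟶w
    shorter 1 _ (step u⟶w stop) = u↛w u⟶w
    shorter (suc (suc _)) (s≤s (s≤s ()))

  Triangle : Fin n → Fin n → Fin n → Set
  Triangle u v w = u ⟶ v × v ⟶ w × u ⟶ w

  module _ {G : Permutation′ n → Set} (G≤Aut : IsAutSubgroup Γ G) where
    open IsAutSubgroup G≤Aut

    transport-⟶ : ∀ {g x y x′ y′} → G g → g ⟨$⟩ʳ x ≡ x′ → g ⟨$⟩ʳ y ≡ y′ →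
                  x ⟶ y → x′ ⟶ y′
    transport-⟶ {g} {x} {y} g∈G refl refl = subst T (sym (aut g g∈G x y))

    module _ (geodesic-transitive : GeodesicTransitive Γ G 2) where

      ⟶-transitive : ∀ {a b c d} → a ⟶ b → c ⟶ d →
                     Σ _ λ g → G g × g ⟨$⟩ʳ a ≡ c × g ⟨$⟩ʳ b ≡ d
      ⟶-transitive a⟶b c⟶d =
        let g , g∈G , g[ab]≡cd =
              geodesic-transitive 1 (s≤s z≤n) _ _ (⟶⇒1-geodesic a⟶b) (⟶⇒1-geodesic c⟶d)
        in g , g∈G , ∷-injectiveˡ g[ab]≡cd , ∷-injectiveˡ (∷-injectiveʳ g[ab]≡cd)

      2-geodesic-transitive :
        ∀ {a b c a′ b′ c′} → IsGeodesic Γ 2 (a ∷ b ∷ c ∷ []) → IsGeodesic Γ 2 (a′ ∷ b′ ∷ c′ ∷ []) →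
        Σ _ λ g → G g × g ⟨$⟩ʳ a ≡ a′ × g ⟨$⟩ʳ b ≡ b′ × g ⟨$⟩ʳ c ≡ c′
      2-geodesic-transitive abc a′b′c′ =
        let g , g∈G , g[abc]≡a′b′c′ = geodesic-transitive 2 ≤-refl _ _ abc a′b′c′
            g[bc]≡b′c′ = ∷-injectiveʳ g[abc]≡a′b′c′
        in g , g∈G , ∷-injectiveˡ g[abc]≡a′b′c′ , ∷-injectiveˡ g[bc]≡b′c′
             , ∷-injectiveˡ (∷-injectiveʳ g[bc]≡b′c′)

      triangle-on-first-side : ∀ {a b c x y} → Triangle a b c → x ⟶ y → ∃ λ z → Triangle x y z
      triangle-on-first-side (a⟶b , b⟶c , a⟶c) x⟶y =
        let g , g∈G , ga≡x , gb≡y = ⟶-transitive a⟶b x⟶y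
        in _ , transport-⟶ g∈G ga≡x gb≡y a⟶b , transport-⟶ g∈G gb≡y refl b⟶c
             , transport-⟶ g∈G ga≡x refl a⟶c

      triangle-on-third-side : ∀ {a b c x y} → Triangle a b c → x ⟶ y → ∃ λ z → Triangle x z y
      triangle-on-third-side (a⟶b , b⟶c , a⟶c) x⟶y =
        let g , g∈G , ga≡x , gc≡y = ⟶-transitive a⟶c x⟶y
        in _ , transport-⟶ g∈G ga≡x refl a⟶b , transport-⟶ g∈G refl gc≡y b⟶c
             , transport-⟶ g∈G ga≡x gc≡y a⟶c

      module _ (valency-3 : HasValency Γ 3) where

        triangle-apex-unique : ∀ {u v w y} → Triangle u v w → u ⟶ y → v ⟶ y → y ≡ w
        triangle-apex-unique {u} {v} {w} {y} t@(u⟶v , v⟶w , u⟶w) u⟶y v⟶y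
          with y ≟ w | triangle-on-third-side t u⟶v
        ... | yes y≡w | _ = y≡w
        ... | no y≢w | x , u⟶x , x⟶v , _ =
          contradiction (Unique⇒length≤valency valency-3 distinct (u⟶v ∷ u⟶w ∷ u⟶y ∷ u⟶x ∷ []))
            λ { (s≤s (s≤s (s≤s ()))) }
          where
          distinct : Unique (v ∷ w ∷ y ∷ x ∷ [])
          distinct = ( (λ { refl → ⟶-irrefl v⟶w })
                     ∷ (λ { refl → ⟶-irrefl v⟶y })
                     ∷ (λ { refl → ⟶-irrefl x⟶v }) ∷ [])
                   ∷ ( (λ w≡y → y≢w (sym w≡y))
                     ∷ (λ { refl → ⟶-asym v⟶w x⟶v }) ∷ [])
                   ∷ ( (λ { refl → ⟶-asym v⟶y x⟶v }) ∷ [])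
                   ∷ [] ∷ []

        no-triangle : ∀ {u v w} → ¬ Triangle u v w
        no-triangle {u} {v} {w} t@(u⟶v , v⟶w , u⟶w) =
          let p , _ , w⟶p , v⟶p = triangle-on-first-side t v⟶w
              q , v⟶q , q⟶w , _ = triangle-on-third-side t v⟶w
              u↛p : ¬ u ⟶ p
              u↛p u⟶p = ⟶-irrefl (subst (w ⟶_) (triangle-apex-unique t u⟶p v⟶p) w⟶p)
              u↛q : ¬ u ⟶ q
              u↛q u⟶q = ⟶-irrefl (subst (_⟶ w) (triangle-apex-unique t u⟶q v⟶q) q⟶w)
              k , k∈G , ku≡u , kv≡v , kp≡q =
                2-geodesic-transitive (chordless-2-arc⇒2-geodesic u⟶v v⟶p u↛p)
                                      (chordless-2-arc⇒2-geodesic u⟶v v⟶q u↛q)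
              kw≡w = triangle-apex-unique t (transport-⟶ k∈G ku≡u refl u⟶w)
                                            (transport-⟶ k∈G kv≡v refl v⟶w)
          in ⟶-asym (transport-⟶ k∈G kw≡w kp≡q w⟶p) q⟶w

        2-arc⇒2-geodesic : (xs : Vec (Fin n) 3) → IsSArc Γ xs → IsGeodesic Γ 2 xs
        2-arc⇒2-geodesic (u ∷ v ∷ w ∷ []) (u⟶v , v⟶w , tt) =
          chordless-2-arc⇒2-geodesic u⟶v v⟶w λ u⟶w → no-triangle (u⟶v , v⟶w , u⟶w)

lemma4p3 : (Γ : Digraph) → (G : Permutation′ (Digraph.n Γ) → Set) →
    IsAutSubgroup Γ G → HasValency Γ 3 → GeodesicTransitive Γ G 2 →
    ArcTransitive Γ G 2
lemma4p3 Γ G G≤Aut valency-3 geodesic-transitive xs ys xs-2-arc ys-2-arc =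
  geodesic-transitive 2 ≤-refl xs ys (isGeodesic xs xs-2-arc) (isGeodesic ys ys-2-arc)
  where
  isGeodesic : (xs : Vec (Fin (Digraph.n Γ)) 3) → IsSArc Γ xs → IsGeodesic Γ 2 xs
  isGeodesic = 2-arc⇒2-geodesic Γ G≤Aut geodesic-transitive valency-3
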